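{- Let $G$ be a finite graph and let $k$ be an integer with $k\ge\omega(G)$. Let $kG$ denote the disjoint union of $k$ copies of $G$. Then $Z_f(kG)=\chi_f(kG)=\chi_f(G)$.
   Context: $\omega(G)$ is the maximum size of a clique of $G$. A fractional coloring of $G$ is an assignment of nonnegative real weights to the independent sets of $G$ such that for every vertex $v$ the total weight of the independent sets containing $v$ is at least $1$; $\chi_f(G)$ is the minimum total weight of a fractional coloring. A fractional cocoloring is defined the same way but weights are assigned to cliques and independent sets, with each vertex covered by total weight at least $1$; $Z_f(G)$ is the minimum total weight of a fractional cocoloring.
   Formalization: The weights that fractional colorings and fractional cocolorings assign to independent sets and cliques take values in the nonnegative rationals instead of the nonnegative reals. -}

module Defs where

open import Data.Nat using (ℕ; zero; suc; _*_)
open import Data.Bool using (Bool; true; false; _∧_; if_then_else_)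
open import Data.Fin using (Fin; remQuot; _≟_)
open import Data.Fin.Subset using (Subset; _∈_; ∣_∣)
open import Data.Vec using (Vec; []; _∷_)
open import Data.List using (List; []; _∷_; map; _++_; foldr)
open import Data.Product using (_×_; _,_; proj₁; proj₂; Σ)
open import Data.Rational using (ℚ; 0ℚ; 1ℚ; _+_; _≤_)
open import Relation.Nullary using (¬_)
import Relation.Nullary
import Data.Empty
import Data.Nat
import Relation.Binary.PropositionalEquality
open import Data.Fin.Subset.Properties using (_∈?_)
open import Relation.Nullary.Decidable using (⌊_⌋)
open import Relation.Binary.PropositionalEquality using (_≡_; _≢_)

record Graph (n : ℕ) : Set where
  field
    adj    : Fin n → Fin n → Bool
    sym    : ∀ u v → adj u v ≡ adj v u
    irrefl : ∀ v → adj v v ≡ false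
open Graph public

module _ {n : ℕ} (G : Graph n) where
  IsIndependent : Subset n → Set
  IsIndependent S = ∀ u v → u ∈ S → v ∈ S → adj G u v ≡ false

  IsClique : Subset n → Set
  IsClique S = ∀ u v → u ∈ S → v ∈ S → u ≢ v → adj G u v ≡ true

CliqueNumber≤ : ∀ {n} → Graph n → ℕ → Set
CliqueNumber≤ {n} G k = ∀ (S : Subset n) → IsClique G S → ∣ S ∣ Data.Nat.≤ k

-- Disjoint union of k copies of G; vertex i of kG is copy (quotient) and
-- vertex (remainder) of G, via Fin (k * n) ≅ Fin k × Fin n.
copies : ∀ {n} (k : ℕ) → Graph n → Graph (k * n)
copies {n} k G = record { adj = a ; sym = s ; irrefl = ir }
  where
  a : Fin (k * n) → Fin (k * n) → Bool
  a i j = ⌊ proj₁ (remQuot {k} n i) ≟ proj₁ (remQuot {k} n j) ⌋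
          ∧ adj G (proj₂ (remQuot {k} n i)) (proj₂ (remQuot {k} n j))
  s : ∀ u v → a u v ≡ a v u
  s u v with proj₁ (remQuot {k} n u) ≟ proj₁ (remQuot {k} n v)
           | proj₁ (remQuot {k} n v) ≟ proj₁ (remQuot {k} n u)
  ... | Relation.Nullary.yes _ | Relation.Nullary.yes _ = Graph.sym G _ _
  ... | Relation.Nullary.yes p | Relation.Nullary.no ¬q =
        Data.Empty.⊥-elim (¬q (Relation.Binary.PropositionalEquality.sym p))
  ... | Relation.Nullary.no ¬p | Relation.Nullary.yes q =
        Data.Empty.⊥-elim (¬p (Relation.Binary.PropositionalEquality.sym q))
  ... | Relation.Nullary.no _ | Relation.Nullary.no _ = Relation.Binary.PropositionalEquality.refl
  ir : ∀ v → a v v ≡ false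
  ir v with proj₁ (remQuot {k} n v) ≟ proj₁ (remQuot {k} n v)
  ... | Relation.Nullary.yes _ = irrefl G _
  ... | Relation.Nullary.no ¬p = Data.Empty.⊥-elim (¬p Relation.Binary.PropositionalEquality.refl)

allSubsets : (n : ℕ) → List (Subset n)
allSubsets zero    = [] ∷ []
allSubsets (suc n) = map (true ∷_) (allSubsets n) ++ map (false ∷_) (allSubsets n)

sumℚ : List ℚ → ℚ
sumℚ = foldr _+_ 0ℚ

total : ∀ {n} → (Subset n → ℚ) → ℚ
total {n} w = sumℚ (map w (allSubsets n))

weightAt : ∀ {n} → (Subset n → ℚ) → Fin n → ℚ
weightAt {n} w v = sumℚ (map (λ S → if ⌊ v ∈? S ⌋ then w S else 0ℚ) (allSubsets n))

module _ {n : ℕ} (G : Graph n) where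
  record FractionalColoring : Set where
    field
      w        : Subset n → ℚ
      nonneg   : ∀ S → 0ℚ ≤ w S
      support  : ∀ S → ¬ IsIndependent G S → w S ≡ 0ℚ
      covers   : ∀ v → 1ℚ ≤ weightAt w v

  record FractionalCocoloring : Set where
    field
      wc       : Subset n → ℚ
      wi       : Subset n → ℚ
      nonnegc  : ∀ S → 0ℚ ≤ wc S
      nonnegi  : ∀ S → 0ℚ ≤ wi S
      supportc : ∀ S → ¬ IsClique G S → wc S ≡ 0ℚ
      supporti : ∀ S → ¬ IsIndependent G S → wi S ≡ 0ℚ
      covers   : ∀ v → 1ℚ ≤ weightAt wc v + weightAt wi v

  coloringWeight : FractionalColoring → ℚ
  coloringWeight c = total (FractionalColoring.w c)

  cocoloringWeight : FractionalCocoloring → ℚ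
  cocoloringWeight c = total (FractionalCocoloring.wc c) + total (FractionalCocoloring.wi c)

  IsChiF : ℚ → Set
  IsChiF r = Σ FractionalColoring (λ c → coloringWeight c ≡ r)
             × (∀ c → r ≤ coloringWeight c)

  IsZF : ℚ → Set
  IsZF r = Σ FractionalCocoloring (λ c → cocoloringWeight c ≡ r)
           × (∀ c → r ≤ cocoloringWeight c)

-- Repeating a fractional coloring of G in every copy gives a fractional coloring
-- of kG of the same weight (`Lifting`), and a fractional coloring is a fractional
-- cocoloring without clique weight (`asCocoloring`); so Z_f(kG) ≤ χ_f(kG) ≤ χ_f(G).
-- Conversely (`Averaging`), a fractional cocoloring of kG yields in each copy i a
-- weighting of G: vertex v becomes the singleton {v} carrying the clique weight
-- at (i, v), and each independent set contributes its part in copy i.  Averaging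
-- over the k copies covers every vertex of G.  A clique of kG lies in one copy,
-- hence has at most ω(G) ≤ k vertices, so its weight is charged at most k times
-- and the average is no heavier than the cocoloring: χ_f(G) ≤ Z_f(kG).

module Submission where

open import Defs hiding (sym)
open import Algebra.Bundles using (CommutativeMonoid)
open import Data.Bool using (Bool; true; false; _∧_; if_then_else_)
open import Data.Bool.Properties using (∧-zeroʳ; ¬-not)
import Data.Bool as Bool
open import Data.Empty using (⊥; ⊥-elim)
open import Data.Fin using (Fin; zero; suc; remQuot; combine; _≟_)
open import Data.Fin.Properties using (remQuot-combine)
open import Data.Fin.Subset using (Subset; _∈_; _∉_; ⁅_⁆; ∣_∣)
open import Data.Fin.Subset.Properties using (_∈?_; x∈⁅y⁆⇒x≡y; ∣⁅x⁆∣≡1; nonempty?)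
open import Data.List using (List; []; _∷_; map; _++_; allFin; tabulate)
open import Data.List.Properties using (map-tabulate)
open import Data.Nat as ℕ using (ℕ; zero; suc; z≤n; s≤s)
open import Data.Product using (Σ; _×_; _,_; proj₁; proj₂)
open import Data.Rational using (ℚ; 0ℚ; 1ℚ; _+_; _*_; _≤_; 1/_; Positive; NonZero; NonNegative; nonNegative)
open import Data.Rational.Properties hiding (_≟_)
open import Data.Vec using ([]; _∷_; lookup)
import Data.Vec as Vec
open import Data.Vec.Properties using (lookup∘tabulate; lookup-replicate; lookup⇒[]=; []=⇒lookup; ≡-dec)
open import Function.Bundles using (_⇔_; mk⇔)
open import Relation.Binary.PropositionalEquality
open import Relation.Nullary using (¬_; Dec; does; yes; no)
open import Relation.Nullary.Decidable using (⌊_⌋; isYes≗does)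
open import Algebra.Properties.CommutativeSemigroup
  (CommutativeMonoid.commutativeSemigroup +-0-commutativeMonoid) using (interchange)

private
  variable
    A B : Set

∑ : List A → (A → ℚ) → ℚ
∑ xs f = sumℚ (map f xs)

∑-cong : ∀ (xs : List A) {f g : A → ℚ} → (∀ a → f a ≡ g a) → ∑ xs f ≡ ∑ xs g
∑-cong []       f≗g = refl
∑-cong (x ∷ xs) f≗g = cong₂ _+_ (f≗g x) (∑-cong xs f≗g)

∑-zero : ∀ (xs : List A) → ∑ xs (λ _ → 0ℚ) ≡ 0ℚ
∑-zero []       = refl
∑-zero (x ∷ xs) = trans (+-identityˡ _) (∑-zero xs)

∑-+ : ∀ (xs : List A) (f g : A → ℚ) → ∑ xs (λ a → f a + g a) ≡ ∑ xs f + ∑ xs g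
∑-+ []       f g = sym (+-identityˡ 0ℚ)
∑-+ (x ∷ xs) f g =
  trans (cong (f x + g x +_) (∑-+ xs f g)) (interchange (f x) (g x) (∑ xs f) (∑ xs g))

∑-* : ∀ (xs : List A) (c : ℚ) (f : A → ℚ) → ∑ xs (λ a → c * f a) ≡ c * ∑ xs f
∑-* []       c f = sym (*-zeroʳ c)
∑-* (x ∷ xs) c f = trans (cong (c * f x +_) (∑-* xs c f)) (sym (*-distribˡ-+ c (f x) (∑ xs f)))

∑-mono : ∀ (xs : List A) {f g : A → ℚ} → (∀ a → f a ≤ g a) → ∑ xs f ≤ ∑ xs g
∑-mono []       f≤g = ≤-refl
∑-mono (x ∷ xs) f≤g = +-mono-≤ (f≤g x) (∑-mono xs f≤g)

∑-nonneg : ∀ (xs : List A) {f : A → ℚ} → (∀ a → 0ℚ ≤ f a) → 0ℚ ≤ ∑ xs f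
∑-nonneg xs f≥0 = ≤-trans (≤-reflexive (sym (∑-zero xs))) (∑-mono xs f≥0)

∑-swap : ∀ (xs : List A) (ys : List B) (F : A → B → ℚ) →
         ∑ xs (λ a → ∑ ys (F a)) ≡ ∑ ys (λ b → ∑ xs (λ a → F a b))
∑-swap []       ys F = sym (∑-zero ys)
∑-swap (x ∷ xs) ys F =
  trans (cong (∑ ys (F x) +_) (∑-swap xs ys F)) (sym (∑-+ ys (F x) (λ b → ∑ xs (λ a → F a b))))

∑-++ : ∀ (xs ys : List A) (f : A → ℚ) → ∑ (xs ++ ys) f ≡ ∑ xs f + ∑ ys f
∑-++ []       ys f = sym (+-identityˡ _)
∑-++ (x ∷ xs) ys f = trans (cong (f x +_) (∑-++ xs ys f)) (sym (+-assoc (f x) _ _))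

∑-map : ∀ (g : B → A) (xs : List B) (f : A → ℚ) → ∑ (map g xs) f ≡ ∑ xs (λ b → f (g b))
∑-map g []       f = refl
∑-map g (x ∷ xs) f = cong (f (g x) +_) (∑-map g xs f)

when : Bool → ℚ → ℚ
when b x = if b then x else 0ℚ

when-zero : ∀ b → when b 0ℚ ≡ 0ℚ
when-zero true  = refl
when-zero false = refl

when-+ : ∀ b x y → when b (x + y) ≡ when b x + when b y
when-+ true  x y = refl
when-+ false x y = sym (+-identityˡ 0ℚ)

when-* : ∀ b c x → when b (c * x) ≡ c * when b x
when-* true  c x = refl
when-* false c x = sym (*-zeroʳ c)

when-comm : ∀ a b x → when a (when b x) ≡ when b (when a x)
when-comm true  b x = refl
when-comm false true  x = refl
when-comm false false x = refl

when-nonneg : ∀ b {x} → 0ℚ ≤ x → 0ℚ ≤ when b x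
when-nonneg true  x≥0 = x≥0
when-nonneg false x≥0 = ≤-refl

when-∑ : ∀ b (xs : List A) (f : A → ℚ) → when b (∑ xs f) ≡ ∑ xs (λ a → when b (f a))
when-∑ true  xs f = refl
when-∑ false xs f = sym (∑-zero xs)

∑-allFin-suc : ∀ {m} (f : Fin (suc m) → ℚ) →
               ∑ (allFin (suc m)) f ≡ f zero + ∑ (allFin m) (λ i → f (suc i))
∑-allFin-suc f =
  cong (λ xs → f zero + sumℚ xs) (trans (map-tabulate suc f) (sym (map-tabulate (λ i → i) (λ i → f (suc i)))))

∑-allSubsets-suc : ∀ {n} (f : Subset (suc n) → ℚ) →
  ∑ (allSubsets (suc n)) f ≡ ∑ (allSubsets n) (λ S → f (true ∷ S)) + ∑ (allSubsets n) (λ S → f (false ∷ S))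
∑-allSubsets-suc {n} f = trans (∑-++ (map (true ∷_) (allSubsets n)) (map (false ∷_) (allSubsets n)) f)
  (cong₂ _+_ (∑-map (true ∷_) (allSubsets n) f) (∑-map (false ∷_) (allSubsets n) f))

_≟ₛ_ : ∀ {n} (S T : Subset n) → Dec (S ≡ T)
_≟ₛ_ = ≡-dec Bool._≟_

-- Every subset occurs exactly once in `allSubsets`.
∑-allSubsets-delta : ∀ {n} (S : Subset n) (h : Subset n → ℚ) →
                     ∑ (allSubsets n) (λ T → when (does (S ≟ₛ T)) (h T)) ≡ h S
∑-allSubsets-delta [] h = +-identityʳ (h [])
∑-allSubsets-delta {suc n} (true ∷ S) h = begin
  ∑ (allSubsets (suc n)) (λ T → when (does ((true ∷ S) ≟ₛ T)) (h T))
    ≡⟨ ∑-allSubsets-suc (λ T → when (does ((true ∷ S) ≟ₛ T)) (h T)) ⟩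
  ∑ (allSubsets n) (λ T → when (does (S ≟ₛ T)) (h (true ∷ T))) + ∑ (allSubsets n) (λ _ → 0ℚ)
    ≡⟨ cong₂ _+_ (∑-allSubsets-delta S (λ T → h (true ∷ T))) (∑-zero (allSubsets n)) ⟩
  h (true ∷ S) + 0ℚ
    ≡⟨ +-identityʳ _ ⟩
  h (true ∷ S) ∎
  where open ≡-Reasoning
∑-allSubsets-delta {suc n} (false ∷ S) h = begin
  ∑ (allSubsets (suc n)) (λ T → when (does ((false ∷ S) ≟ₛ T)) (h T))
    ≡⟨ ∑-allSubsets-suc (λ T → when (does ((false ∷ S) ≟ₛ T)) (h T)) ⟩
  ∑ (allSubsets n) (λ _ → 0ℚ) + ∑ (allSubsets n) (λ T → when (does (S ≟ₛ T)) (h (false ∷ T)))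
    ≡⟨ cong₂ _+_ (∑-zero (allSubsets n)) (∑-allSubsets-delta S (λ T → h (false ∷ T))) ⟩
  0ℚ + h (false ∷ S)
    ≡⟨ +-identityˡ _ ⟩
  h (false ∷ S) ∎
  where open ≡-Reasoning

-- Every vertex occurs exactly once in `allFin`.
∑-allFin-delta : ∀ {m} (u : Fin m) (h : Fin m → ℚ) → ∑ (allFin m) (λ v → when (does (u ≟ v)) (h v)) ≡ h u
∑-allFin-delta {suc m} zero h =
  trans (∑-allFin-suc (λ v → when (does (zero ≟ v)) (h v))) (trans (cong (h zero +_) (∑-zero (allFin m))) (+-identityʳ _))
∑-allFin-delta (suc u) h =
  trans (∑-allFin-suc (λ v → when (does (suc u ≟ v)) (h v))) (trans (+-identityˡ _) (∑-allFin-delta u (λ v → h (suc v))))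

⟦_⟧ : ℕ → ℚ
⟦ zero ⟧  = 0ℚ
⟦ suc m ⟧ = 1ℚ + ⟦ m ⟧

⟦⟧-nonneg : ∀ m → 0ℚ ≤ ⟦ m ⟧
⟦⟧-nonneg zero    = ≤-refl
⟦⟧-nonneg (suc m) = ≤-trans (≤-reflexive (sym (+-identityˡ 0ℚ))) (+-mono-≤ (nonNegative⁻¹ 1ℚ) (⟦⟧-nonneg m))

⟦⟧-mono : ∀ {m n} → m ℕ.≤ n → ⟦ m ⟧ ≤ ⟦ n ⟧
⟦⟧-mono {n = n} z≤n = ⟦⟧-nonneg n
⟦⟧-mono (s≤s m≤n) = +-monoʳ-≤ 1ℚ (⟦⟧-mono m≤n)

∑-allFin-const : ∀ m (x : ℚ) → ∑ (allFin m) (λ _ → x) ≡ ⟦ m ⟧ * x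
∑-allFin-const zero    x = sym (*-zeroˡ x)
∑-allFin-const (suc m) x = begin
  ∑ (allFin (suc m)) (λ _ → x)   ≡⟨ ∑-allFin-suc {m} (λ _ → x) ⟩
  x + ∑ (allFin m) (λ _ → x)     ≡⟨ cong₂ _+_ (sym (*-identityˡ x)) (∑-allFin-const m x) ⟩
  1ℚ * x + ⟦ m ⟧ * x             ≡⟨ sym (*-distribʳ-+ x 1ℚ ⟦ m ⟧) ⟩
  ⟦ suc m ⟧ * x                  ∎
  where open ≡-Reasoning

∑-allFin-count : ∀ {n} (T : Subset n) → ∑ (allFin n) (λ v → when (lookup T v) 1ℚ) ≡ ⟦ ∣ T ∣ ⟧
∑-allFin-count []          = refl
∑-allFin-count (true ∷ T)  = trans (∑-allFin-suc (λ v → when (lookup (true ∷ T) v) 1ℚ)) (cong (1ℚ +_) (∑-allFin-count T))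
∑-allFin-count (false ∷ T) = trans (∑-allFin-suc (λ v → when (lookup (false ∷ T) v) 1ℚ)) (trans (+-identityˡ _) (∑-allFin-count T))

∈?-lookup : ∀ {n} (v : Fin n) (S : Subset n) → ⌊ v ∈? S ⌋ ≡ lookup S v
∈?-lookup v S = trans (isYes≗does (v ∈? S)) (does-∈? v S)
  where
  does-∈? : ∀ {n} (v : Fin n) (S : Subset n) → does (v ∈? S) ≡ lookup S v
  does-∈? zero    (true ∷ S)  = refl
  does-∈? zero    (false ∷ S) = refl
  does-∈? (suc v) (b ∷ S)     = does-∈? v S

lookup-∉ : ∀ {n} {v : Fin n} {S : Subset n} → v ∉ S → lookup S v ≡ false
lookup-∉ {v = v} {S} v∉S = ¬-not (λ Sv≡true → v∉S (lookup⇒[]= v S Sv≡true))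

lookup-⁅⁆ : ∀ {n} (u v : Fin n) → lookup ⁅ v ⁆ u ≡ does (u ≟ v)
lookup-⁅⁆ zero    zero    = refl
lookup-⁅⁆ zero    (suc v) = refl
lookup-⁅⁆ (suc u) zero    = lookup-replicate u false
lookup-⁅⁆ (suc u) (suc v) = lookup-⁅⁆ u v

weightAt-lookup : ∀ {n} (w : Subset n → ℚ) (v : Fin n) →
                  weightAt w v ≡ ∑ (allSubsets n) (λ S → when (lookup S v) (w S))
weightAt-lookup {n} w v = ∑-cong (allSubsets n) (λ S → cong (λ b → when b (w S)) (∈?-lookup v S))

weightAt-+ : ∀ {n} (f g : Subset n → ℚ) v → weightAt (λ S → f S + g S) v ≡ weightAt f v + weightAt g v
weightAt-+ {n} f g v = trans (∑-cong (allSubsets n) (λ S → when-+ ⌊ v ∈? S ⌋ (f S) (g S)))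
                             (∑-+ (allSubsets n) _ _)

weightAt-* : ∀ {n} (c : ℚ) (f : Subset n → ℚ) v → weightAt (λ S → c * f S) v ≡ c * weightAt f v
weightAt-* {n} c f v = trans (∑-cong (allSubsets n) (λ S → when-* ⌊ v ∈? S ⌋ c (f S)))
                             (∑-* (allSubsets n) c _)

weightAt-∑ : ∀ {n} (xs : List A) (F : A → Subset n → ℚ) v →
             weightAt (λ S → ∑ xs (λ a → F a S)) v ≡ ∑ xs (λ a → weightAt (F a) v)
weightAt-∑ {n = n} xs F v = trans (∑-cong (allSubsets n) (λ S → when-∑ ⌊ v ∈? S ⌋ xs (λ a → F a S)))
                                  (∑-swap (allSubsets n) xs _)

weightAt-zero : ∀ {n} (v : Fin n) → weightAt {n} (λ _ → 0ℚ) v ≡ 0ℚ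
weightAt-zero {n} v = trans (∑-cong (allSubsets n) (λ S → when-zero ⌊ v ∈? S ⌋)) (∑-zero (allSubsets n))

weightAt-nonneg : ∀ {n} {w : Subset n → ℚ} → (∀ S → 0ℚ ≤ w S) → ∀ v → 0ℚ ≤ weightAt w v
weightAt-nonneg {n} w≥0 v = ∑-nonneg (allSubsets n) (λ S → when-nonneg ⌊ v ∈? S ⌋ (w≥0 S))

push : ∀ {m} → List A → (A → Subset m) → (A → ℚ) → Subset m → ℚ
push xs f w T = ∑ xs (λ a → when (does (f a ≟ₛ T)) (w a))

total-push : ∀ {m} (xs : List A) (f : A → Subset m) (w : A → ℚ) → total (push xs f w) ≡ ∑ xs w
total-push {m = m} xs f w = trans (∑-swap (allSubsets m) xs _)
  (∑-cong xs (λ a → ∑-allSubsets-delta (f a) (λ _ → w a)))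

weightAt-push : ∀ {m} (xs : List A) (f : A → Subset m) (w : A → ℚ) (u : Fin m) →
                weightAt (push xs f w) u ≡ ∑ xs (λ a → when (lookup (f a) u) (w a))
weightAt-push {m = m} xs f w u = begin
  weightAt (push xs f w) u
    ≡⟨ weightAt-lookup (push xs f w) u ⟩
  ∑ (allSubsets m) (λ T → when (lookup T u) (∑ xs (λ a → when (does (f a ≟ₛ T)) (w a))))
    ≡⟨ ∑-cong (allSubsets m) (λ T → trans (when-∑ (lookup T u) xs _)
         (∑-cong xs (λ a → when-comm (lookup T u) (does (f a ≟ₛ T)) (w a)))) ⟩
  ∑ (allSubsets m) (λ T → ∑ xs (λ a → when (does (f a ≟ₛ T)) (when (lookup T u) (w a))))
    ≡⟨ ∑-swap (allSubsets m) xs _ ⟩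
  ∑ xs (λ a → ∑ (allSubsets m) (λ T → when (does (f a ≟ₛ T)) (when (lookup T u) (w a))))
    ≡⟨ ∑-cong xs (λ a → ∑-allSubsets-delta (f a) (λ T → when (lookup T u) (w a))) ⟩
  ∑ xs (λ a → when (lookup (f a) u) (w a)) ∎
  where open ≡-Reasoning

push-nonneg : ∀ {m} (xs : List A) (f : A → Subset m) {w : A → ℚ} →
              (∀ a → 0ℚ ≤ w a) → ∀ T → 0ℚ ≤ push xs f w T
push-nonneg xs f w≥0 T = ∑-nonneg xs (λ a → when-nonneg (does (f a ≟ₛ T)) (w≥0 a))

push-support : ∀ {m} (xs : List A) (f : A → Subset m) {w : A → ℚ} (Q : Subset m → Set) →
               (∀ a → ¬ Q (f a) → w a ≡ 0ℚ) → ∀ T → ¬ Q T → push xs f w T ≡ 0ℚ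
push-support xs f {w} Q vanish T ¬QT = trans (∑-cong xs term) (∑-zero xs)
  where
  term : ∀ a → when (does (f a ≟ₛ T)) (w a) ≡ 0ℚ
  term a with f a ≟ₛ T
  ... | yes refl = vanish a ¬QT
  ... | no _     = refl

singleton-independent : ∀ {n} (G : Graph n) v → IsIndependent G ⁅ v ⁆
singleton-independent G v u w u∈ w∈ rewrite x∈⁅y⁆⇒x≡y v u∈ | x∈⁅y⁆⇒x≡y v w∈ = irrefl G v

singleton-clique : ∀ {n} (G : Graph n) v → IsClique G ⁅ v ⁆
singleton-clique G v u w u∈ w∈ u≢w = ⊥-elim (u≢w (trans (x∈⁅y⁆⇒x≡y v u∈) (sym (x∈⁅y⁆⇒x≡y v w∈))))

cliqueNumber≤0-noVertex : ∀ {n} (G : Graph n) → CliqueNumber≤ G 0 → Fin n → ⊥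
cliqueNumber≤0-noVertex G ω≤0 v =
  1≰0 (subst (ℕ._≤ 0) (∣⁅x⁆∣≡1 v) (ω≤0 ⁅ v ⁆ (singleton-clique G v)))
  where
  1≰0 : ¬ (1 ℕ.≤ 0)
  1≰0 ()

module Copies {n : ℕ} (G : Graph n) (k : ℕ) where

  kG : Graph (k ℕ.* n)
  kG = copies k G

  copyOf : Fin (k ℕ.* n) → Fin k
  copyOf x = proj₁ (remQuot {k} n x)

  vertexOf : Fin (k ℕ.* n) → Fin n
  vertexOf x = proj₂ (remQuot {k} n x)

  copyOf-combine : ∀ i v → copyOf (combine i v) ≡ i
  copyOf-combine i v = cong proj₁ (remQuot-combine {k} {n} i v)

  vertexOf-combine : ∀ i v → vertexOf (combine i v) ≡ v
  vertexOf-combine i v = cong proj₂ (remQuot-combine {k} {n} i v)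

  adj-sameCopy : ∀ x y → copyOf x ≡ copyOf y → adj kG x y ≡ adj G (vertexOf x) (vertexOf y)
  adj-sameCopy x y same with copyOf x ≟ copyOf y
  ... | yes _ = refl
  ... | no different = ⊥-elim (different same)

  adj-otherCopy : ∀ x y → copyOf x ≢ copyOf y → adj kG x y ≡ false
  adj-otherCopy x y different with copyOf x ≟ copyOf y
  ... | yes same = ⊥-elim (different same)
  ... | no _     = refl

  adj-combine : ∀ i u v → adj kG (combine i u) (combine i v) ≡ adj G u v
  adj-combine i u v = trans (adj-sameCopy (combine i u) (combine i v)
                              (trans (copyOf-combine i u) (sym (copyOf-combine i v))))
                            (cong₂ (adj G) (vertexOf-combine i u) (vertexOf-combine i v))

  restrict : Fin k → Subset (k ℕ.* n) → Subset n
  restrict i S = Vec.tabulate (λ v → lookup S (combine i v))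

  blowUp : Subset n → Subset (k ℕ.* n)
  blowUp T = Vec.tabulate (λ x → lookup T (vertexOf x))

  lookup-restrict : ∀ i S v → lookup (restrict i S) v ≡ lookup S (combine i v)
  lookup-restrict i S v = lookup∘tabulate (λ v → lookup S (combine i v)) v

  lookup-blowUp : ∀ T x → lookup (blowUp T) x ≡ lookup T (vertexOf x)
  lookup-blowUp T x = lookup∘tabulate (λ x → lookup T (vertexOf x)) x

  ∈-restrict : ∀ {i S v} → v ∈ restrict i S → combine i v ∈ S
  ∈-restrict {i} {S} {v} v∈ =
    lookup⇒[]= (combine i v) S (trans (sym (lookup-restrict i S v)) ([]=⇒lookup v∈))

  ∈-blowUp : ∀ {T x} → x ∈ blowUp T → vertexOf x ∈ T
  ∈-blowUp {T} {x} x∈ = lookup⇒[]= (vertexOf x) T (trans (sym (lookup-blowUp T x)) ([]=⇒lookup x∈))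

  restrict-independent : ∀ i S → IsIndependent kG S → IsIndependent G (restrict i S)
  restrict-independent i S indep u v u∈ v∈ =
    trans (sym (adj-combine i u v)) (indep _ _ (∈-restrict u∈) (∈-restrict v∈))

  restrict-clique : ∀ i Q → IsClique kG Q → IsClique G (restrict i Q)
  restrict-clique i Q clique u v u∈ v∈ u≢v =
    trans (sym (adj-combine i u v)) (clique _ _ (∈-restrict u∈) (∈-restrict v∈)
      (λ iu≡iv → u≢v (trans (sym (vertexOf-combine i u)) (trans (cong vertexOf iu≡iv) (vertexOf-combine i v)))))

  blowUp-independent : ∀ T → IsIndependent G T → IsIndependent kG (blowUp T)
  blowUp-independent T indep x y x∈ y∈ =
    trans (cong (⌊ copyOf x ≟ copyOf y ⌋ ∧_) (indep _ _ (∈-blowUp x∈) (∈-blowUp y∈))) (∧-zeroʳ _)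

  clique-oneCopy : ∀ Q → IsClique kG Q → ∀ {x y} → x ∈ Q → y ∈ Q → copyOf x ≡ copyOf y
  clique-oneCopy Q clique {x} {y} x∈ y∈ with copyOf x ≟ copyOf y
  ... | yes same = same
  ... | no different = ⊥-elim (true≢false (trans (sym (clique x y x∈ y∈ x≢y)) (adj-otherCopy x y different)))
    where
    x≢y : x ≢ y
    x≢y x≡y = different (cong copyOf x≡y)
    true≢false : true ≢ false
    true≢false ()

  copyCount : Subset (k ℕ.* n) → Fin k → ℚ
  copyCount Q i = ∑ (allFin n) (λ v → when (lookup Q (combine i v)) 1ℚ)

  copyCount-restrict : ∀ Q i → copyCount Q i ≡ ⟦ ∣ restrict i Q ∣ ⟧
  copyCount-restrict Q i =
    trans (∑-cong (allFin n) (λ v → cong (λ b → when b 1ℚ) (sym (lookup-restrict i Q v))))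
          (∑-allFin-count (restrict i Q))

  copyCount-empty : ∀ Q i → (∀ v → combine i v ∉ Q) → copyCount Q i ≡ 0ℚ
  copyCount-empty Q i avoids =
    trans (∑-cong (allFin n) (λ v → cong (λ b → when b 1ℚ) (lookup-∉ (avoids v)))) (∑-zero (allFin n))

  -- If ω(G) ≤ k then every clique of kG has at most k vertices: it lies in
  -- one copy, where it is a clique of G.
  clique-size : CliqueNumber≤ G k → ∀ Q → IsClique kG Q → ∑ (allFin k) (copyCount Q) ≤ ⟦ k ⟧
  clique-size ω≤k Q clique with nonempty? Q
  ... | no empty = begin
    ∑ (allFin k) (copyCount Q)   ≡⟨ ∑-cong (allFin k) (λ i → copyCount-empty Q i (λ v v∈ → empty (_ , v∈))) ⟩
    ∑ (allFin k) (λ _ → 0ℚ)      ≡⟨ ∑-zero (allFin k) ⟩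
    0ℚ                           ≤⟨ ⟦⟧-nonneg k ⟩
    ⟦ k ⟧                        ∎
    where open ≤-Reasoning
  ... | yes (x , x∈Q) = begin
    ∑ (allFin k) (copyCount Q)                                       ≡⟨ ∑-cong (allFin k) onlyCopyOf-x ⟩
    ∑ (allFin k) (λ j → when (does (copyOf x ≟ j)) (copyCount Q j))  ≡⟨ ∑-allFin-delta (copyOf x) (copyCount Q) ⟩
    copyCount Q (copyOf x)                                           ≡⟨ copyCount-restrict Q (copyOf x) ⟩
    ⟦ ∣ restrict (copyOf x) Q ∣ ⟧                                    ≤⟨ ⟦⟧-mono (ω≤k _ (restrict-clique (copyOf x) Q clique)) ⟩
    ⟦ k ⟧                                                            ∎
    where
    open ≤-Reasoning
    onlyCopyOf-x : ∀ j → copyCount Q j ≡ when (does (copyOf x ≟ j)) (copyCount Q j)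
    onlyCopyOf-x j with copyOf x ≟ j
    ... | yes _    = refl
    ... | no other = copyCount-empty Q j
                       (λ v v∈ → other (trans (clique-oneCopy Q clique x∈Q v∈) (copyOf-combine j v)))

module _ {m : ℕ} {H : Graph m} where
  open FractionalColoring

  asCocoloring : FractionalColoring H → FractionalCocoloring H
  asCocoloring d = record
    { wc = λ _ → 0ℚ ; wi = w d
    ; nonnegc = λ _ → ≤-refl ; nonnegi = nonneg d
    ; supportc = λ _ _ → refl ; supporti = support d
    ; covers = λ v → ≤-trans (covers d v)
        (≤-reflexive (sym (trans (cong (_+ weightAt (w d) v) (weightAt-zero v)) (+-identityˡ _)))) }

  asCocoloring-weight : ∀ d → cocoloringWeight H (asCocoloring d) ≡ coloringWeight H d
  asCocoloring-weight d = trans (cong (_+ total (w d)) (∑-zero (allSubsets m))) (+-identityˡ _)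

module Lifting {n : ℕ} (G : Graph n) (k : ℕ) where
  open Copies G k
  open FractionalColoring

  liftColoring : FractionalColoring G → FractionalColoring kG
  liftColoring d = record
    { w = lifted
    ; nonneg = push-nonneg (allSubsets n) blowUp (nonneg d)
    ; support = push-support (allSubsets n) blowUp (IsIndependent kG)
        (λ T ¬indep → support d T (λ indep → ¬indep (blowUp-independent T indep)))
    ; covers = λ x → ≤-trans (covers d (vertexOf x)) (≤-reflexive (lifted-weightAt x)) }
    where
    lifted : Subset (k ℕ.* n) → ℚ
    lifted = push (allSubsets n) blowUp (w d)

    lifted-weightAt : ∀ x → weightAt (w d) (vertexOf x) ≡ weightAt lifted x
    lifted-weightAt x = begin
      weightAt (w d) (vertexOf x)
        ≡⟨ weightAt-lookup (w d) (vertexOf x) ⟩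
      ∑ (allSubsets n) (λ T → when (lookup T (vertexOf x)) (w d T))
        ≡⟨ ∑-cong (allSubsets n) (λ T → cong (λ b → when b (w d T)) (sym (lookup-blowUp T x))) ⟩
      ∑ (allSubsets n) (λ T → when (lookup (blowUp T) x) (w d T))
        ≡⟨ sym (weightAt-push (allSubsets n) blowUp (w d) x) ⟩
      weightAt lifted x ∎
      where open ≡-Reasoning

  liftColoring-weight : ∀ d → coloringWeight kG (liftColoring d) ≡ coloringWeight G d
  liftColoring-weight d = total-push (allSubsets n) blowUp (w d)

-- Averaging over the k ≥ 1 copies turns a fractional cocoloring of kG into a
-- fractional coloring of G that is no heavier: copy i contributes the singleton
-- {v} with the clique weight at (i, v), plus the parts in copy i of the
-- independent sets.  Since a clique of kG has at most k vertices, the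
-- singletons cost at most k times the clique weight.
module Averaging {n : ℕ} (G : Graph n) (k' : ℕ) (ω≤k : CliqueNumber≤ G (suc k')) where
  open Copies G (suc k')
  open FractionalCocoloring

  K : ℚ
  K = ⟦ suc k' ⟧

  instance
    K-positive : Positive K
    K-positive = pos+nonNeg⇒pos 1ℚ ⟦ k' ⟧ {{nonNegative (⟦⟧-nonneg k')}}

    K-nonZero : NonZero K
    K-nonZero = pos⇒nonZero K

    1/K-nonNegative : NonNegative (1/ K)
    1/K-nonNegative = pos⇒nonNeg (1/ K) {{1/pos⇒pos K}}

  module _ (co : FractionalCocoloring kG) where

    cliqueLoad : Fin (suc k' ℕ.* n) → ℚ
    cliqueLoad x = weightAt (wc co) x

    inCopy : Fin (suc k') → Subset n → ℚ
    inCopy i T = push (allFin n) ⁅_⁆ (λ v → cliqueLoad (combine i v)) T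
               + push (allSubsets (suc k' ℕ.* n)) (restrict i) (wi co) T

    averaged : Subset n → ℚ
    averaged T = 1/ K * ∑ (allFin (suc k')) (λ i → inCopy i T)

    weightAt-inCopy : ∀ i u → weightAt (inCopy i) u ≡ cliqueLoad (combine i u) + weightAt (wi co) (combine i u)
    weightAt-inCopy i u = trans (weightAt-+ _ _ u) (cong₂ _+_ singletons parts)
      where
      load : Fin n → ℚ
      load v = cliqueLoad (combine i v)

      singletons : weightAt (push (allFin n) ⁅_⁆ load) u ≡ load u
      singletons = trans (weightAt-push (allFin n) ⁅_⁆ load u)
        (trans (∑-cong (allFin n) (λ v → cong (λ b → when b (load v)) (lookup-⁅⁆ u v)))
               (∑-allFin-delta u load))

      parts : weightAt (push (allSubsets (suc k' ℕ.* n)) (restrict i) (wi co)) u ≡ weightAt (wi co) (combine i u)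
      parts = trans (weightAt-push (allSubsets (suc k' ℕ.* n)) (restrict i) (wi co) u)
        (trans (∑-cong (allSubsets (suc k' ℕ.* n)) (λ S → cong (λ b → when b (wi co S)) (lookup-restrict i S u)))
               (sym (weightAt-lookup (wi co) (combine i u))))

    total-inCopy : ∀ i → total (inCopy i) ≡ ∑ (allFin n) (λ v → cliqueLoad (combine i v)) + total (wi co)
    total-inCopy i = trans (∑-+ (allSubsets n) _ _)
      (cong₂ _+_ (total-push (allFin n) ⁅_⁆ (λ v → cliqueLoad (combine i v)))
                 (total-push (allSubsets (suc k' ℕ.* n)) (restrict i) (wi co)))

    averaged-covers : ∀ u → 1ℚ ≤ weightAt averaged u
    averaged-covers u = begin
      1ℚ
        ≡⟨ sym (*-inverseˡ K) ⟩
      1/ K * K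
        ≡⟨ cong (1/ K *_) (sym (trans (∑-allFin-const (suc k') 1ℚ) (*-identityʳ K))) ⟩
      1/ K * ∑ (allFin (suc k')) (λ _ → 1ℚ)
        ≤⟨ *-monoˡ-≤-nonNeg (1/ K) (∑-mono (allFin (suc k')) (λ i → covers co (combine i u))) ⟩
      1/ K * ∑ (allFin (suc k')) (λ i → cliqueLoad (combine i u) + weightAt (wi co) (combine i u))
        ≡⟨ cong (1/ K *_) (sym (∑-cong (allFin (suc k')) (λ i → weightAt-inCopy i u))) ⟩
      1/ K * ∑ (allFin (suc k')) (λ i → weightAt (inCopy i) u)
        ≡⟨ cong (1/ K *_) (sym (weightAt-∑ (allFin (suc k')) inCopy u)) ⟩
      1/ K * weightAt (λ T → ∑ (allFin (suc k')) (λ i → inCopy i T)) u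
        ≡⟨ sym (weightAt-* (1/ K) _ u) ⟩
      weightAt averaged u ∎
      where open ≤-Reasoning

    -- Each clique Q is charged once for every vertex it has, i.e. at most k times.
    cliqueLoad-total : ∑ (allFin (suc k')) (λ i → ∑ (allFin n) (λ v → cliqueLoad (combine i v)))
                       ≤ K * total (wc co)
    cliqueLoad-total = begin
      ∑ (allFin (suc k')) (λ i → ∑ (allFin n) (λ v → cliqueLoad (combine i v)))
        ≡⟨ ∑-cong (allFin (suc k')) (λ i → ∑-cong (allFin n) (λ v → weightAt-lookup (wc co) (combine i v))) ⟩
      ∑ (allFin (suc k')) (λ i → ∑ (allFin n) (λ v → ∑ cliques (λ Q → charge Q i v)))
        ≡⟨ ∑-cong (allFin (suc k')) (λ i → ∑-swap (allFin n) cliques (charge⃗ i)) ⟩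
      ∑ (allFin (suc k')) (λ i → ∑ cliques (λ Q → ∑ (allFin n) (charge Q i)))
        ≡⟨ ∑-swap (allFin (suc k')) cliques (λ i Q → ∑ (allFin n) (charge Q i)) ⟩
      ∑ cliques (λ Q → ∑ (allFin (suc k')) (λ i → ∑ (allFin n) (charge Q i)))
        ≡⟨ ∑-cong cliques charge-count ⟩
      ∑ cliques (λ Q → wc co Q * ∑ (allFin (suc k')) (copyCount Q))
        ≤⟨ ∑-mono cliques clique-bound ⟩
      ∑ cliques (λ Q → K * wc co Q)
        ≡⟨ ∑-* cliques K (wc co) ⟩
      K * total (wc co) ∎
      where
      open ≤-Reasoning
      cliques : List (Subset (suc k' ℕ.* n))
      cliques = allSubsets (suc k' ℕ.* n)

      charge : Subset (suc k' ℕ.* n) → Fin (suc k') → Fin n → ℚ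
      charge Q i v = when (lookup Q (combine i v)) (wc co Q)

      charge⃗ : Fin (suc k') → Fin n → Subset (suc k' ℕ.* n) → ℚ
      charge⃗ i v Q = charge Q i v

      charge-count : ∀ Q → ∑ (allFin (suc k')) (λ i → ∑ (allFin n) (charge Q i))
                           ≡ wc co Q * ∑ (allFin (suc k')) (copyCount Q)
      charge-count Q = trans
        (∑-cong (allFin (suc k')) (λ i → trans (∑-cong (allFin n) (λ v → when-scale (lookup Q (combine i v))))
                                                (∑-* (allFin n) (wc co Q) _)))
        (∑-* (allFin (suc k')) (wc co Q) _)
        where
        when-scale : ∀ b → when b (wc co Q) ≡ wc co Q * when b 1ℚ
        when-scale b = trans (cong (when b) (sym (*-identityʳ (wc co Q)))) (when-* b (wc co Q) 1ℚ)

      clique-bound : ∀ Q → wc co Q * ∑ (allFin (suc k')) (copyCount Q) ≤ K * wc co Q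
      clique-bound Q with ∑ (allFin (suc k')) (copyCount Q) ≤? K
      ... | yes small = ≤-trans (*-monoˡ-≤-nonNeg (wc co Q) {{nonNegative (nonnegc co Q)}} small)
                                (≤-reflexive (*-comm (wc co Q) K))
      ... | no large = ≤-reflexive (begin-equality
            wc co Q * size  ≡⟨ cong (_* size) notClique ⟩
            0ℚ * size       ≡⟨ *-zeroˡ size ⟩
            0ℚ              ≡⟨ sym (*-zeroʳ K) ⟩
            K * 0ℚ          ≡⟨ cong (K *_) (sym notClique) ⟩
            K * wc co Q     ∎)
        where
        size : ℚ
        size = ∑ (allFin (suc k')) (copyCount Q)
        notClique : wc co Q ≡ 0ℚ
        notClique = supportc co Q (λ clique → large (clique-size ω≤k Q clique))

    averaged-total : total averaged ≤ cocoloringWeight kG co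
    averaged-total = begin
      total averaged
        ≡⟨ ∑-* (allSubsets n) (1/ K) _ ⟩
      1/ K * ∑ (allSubsets n) (λ T → ∑ (allFin (suc k')) (λ i → inCopy i T))
        ≡⟨ cong (1/ K *_) (∑-swap (allSubsets n) (allFin (suc k')) (λ T i → inCopy i T)) ⟩
      1/ K * ∑ (allFin (suc k')) (λ i → total (inCopy i))
        ≡⟨ cong (1/ K *_) (trans (∑-cong (allFin (suc k')) total-inCopy)
             (∑-+ (allFin (suc k')) (λ i → ∑ (allFin n) (λ v → cliqueLoad (combine i v))) (λ _ → total (wi co)))) ⟩
      1/ K * (∑ (allFin (suc k')) (λ i → ∑ (allFin n) (λ v → cliqueLoad (combine i v)))
              + ∑ (allFin (suc k')) (λ _ → total (wi co)))
        ≤⟨ *-monoˡ-≤-nonNeg (1/ K) (+-mono-≤ cliqueLoad-total (≤-reflexive (∑-allFin-const (suc k') (total (wi co))))) ⟩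
      1/ K * (K * total (wc co) + K * total (wi co))
        ≡⟨ cong (1/ K *_) (sym (*-distribˡ-+ K (total (wc co)) (total (wi co)))) ⟩
      1/ K * (K * cocoloringWeight kG co)
        ≡⟨ sym (*-assoc (1/ K) K _) ⟩
      (1/ K * K) * cocoloringWeight kG co
        ≡⟨ trans (cong (_* cocoloringWeight kG co) (*-inverseˡ K)) (*-identityˡ _) ⟩
      cocoloringWeight kG co ∎
      where open ≤-Reasoning

    averaged-nonneg : ∀ T → 0ℚ ≤ averaged T
    averaged-nonneg T = ≤-trans (≤-reflexive (sym (*-zeroʳ (1/ K))))
      (*-monoˡ-≤-nonNeg (1/ K) (∑-nonneg (allFin (suc k')) (λ i →
        ≤-trans (≤-reflexive (sym (+-identityˡ 0ℚ)))
          (+-mono-≤ (push-nonneg (allFin n) ⁅_⁆ (λ v → weightAt-nonneg (nonnegc co) (combine i v)) T)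
                    (push-nonneg (allSubsets (suc k' ℕ.* n)) (restrict i) (nonnegi co) T)))))

    -- Both kinds of contribution are independent sets of G.
    averaged-support : ∀ T → ¬ IsIndependent G T → averaged T ≡ 0ℚ
    averaged-support T ¬indep =
      trans (cong (1/ K *_) (trans (∑-cong (allFin (suc k')) inCopy-vanishes) (∑-zero (allFin (suc k')))))
            (*-zeroʳ (1/ K))
      where
      inCopy-vanishes : ∀ i → inCopy i T ≡ 0ℚ
      inCopy-vanishes i = trans (cong₂ _+_
        (push-support (allFin n) ⁅_⁆ (IsIndependent G)
           (λ v ¬indep⁅v⁆ → ⊥-elim (¬indep⁅v⁆ (singleton-independent G v))) T ¬indep)
        (push-support (allSubsets (suc k' ℕ.* n)) (restrict i) (IsIndependent G)
           (λ S ¬indepPart → supporti co S (λ indep → ¬indepPart (restrict-independent i S indep))) T ¬indep))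
        (+-identityˡ 0ℚ)

    averagedColoring : FractionalColoring G
    averagedColoring = record
      { w = averaged ; nonneg = averaged-nonneg ; support = averaged-support ; covers = averaged-covers }

emptyColoring : ∀ {n} (G : Graph n) → (Fin n → ⊥) → FractionalColoring G
emptyColoring G noVertex = record
  { w = λ _ → 0ℚ ; nonneg = λ _ → ≤-refl ; support = λ _ _ → refl ; covers = λ v → ⊥-elim (noVertex v) }

cocoloringWeight-nonneg : ∀ {n} {H : Graph n} (co : FractionalCocoloring H) → 0ℚ ≤ cocoloringWeight H co
cocoloringWeight-nonneg {n} co = ≤-trans (≤-reflexive (sym (+-identityˡ 0ℚ)))
  (+-mono-≤ (∑-nonneg (allSubsets n) (nonnegc co)) (∑-nonneg (allSubsets n) (nonnegi co)))
  where open FractionalCocoloring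

reduce : ∀ {n} (G : Graph n) k → CliqueNumber≤ G k → FractionalCocoloring (copies k G) → FractionalColoring G
reduce G zero     ω≤0 co = emptyColoring G (cliqueNumber≤0-noVertex G ω≤0)
reduce G (suc k') ω≤k co = Averaging.averagedColoring G k' ω≤k co

reduce-weight : ∀ {n} (G : Graph n) k (ω≤k : CliqueNumber≤ G k) (co : FractionalCocoloring (copies k G)) →
                coloringWeight G (reduce G k ω≤k co) ≤ cocoloringWeight (copies k G) co
reduce-weight {n} G zero     ω≤0 co = ≤-trans (≤-reflexive (∑-zero (allSubsets n))) (cocoloringWeight-nonneg co)
reduce-weight     G (suc k') ω≤k co = Averaging.averaged-total G k' ω≤k co

IsMinimum : {A : Set} → (A → ℚ) → ℚ → Set
IsMinimum {A} weight r = Σ A (λ a → weight a ≡ r) × (∀ a → r ≤ weight a)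

minimum-transfer : ∀ {A B : Set} (weightA : A → ℚ) (weightB : B → ℚ) (up : A → B) (down : B → A) →
                   (∀ a → weightB (up a) ≡ weightA a) → (∀ b → weightA (down b) ≤ weightB b) →
                   ∀ r → IsMinimum weightB r ⇔ IsMinimum weightA r
minimum-transfer weightA weightB up down up-weight down-weight r = mk⇔ toA toB
  where
  toA : IsMinimum weightB r → IsMinimum weightA r
  toA ((b , b≡r) , minB) = (down b , ≤-antisym (≤-trans (down-weight b) (≤-reflexive b≡r)) (lowerA (down b))) , lowerA
    where
    lowerA : ∀ a → r ≤ weightA a
    lowerA a = ≤-trans (minB (up a)) (≤-reflexive (up-weight a))

  toB : IsMinimum weightA r → IsMinimum weightB r
  toB ((a , a≡r) , minA) = (up a , trans (up-weight a) a≡r) , λ b → ≤-trans (minA (down b)) (down-weight b)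

theorem3 : ∀ {n : ℕ} (G : Graph n) (k : ℕ) → CliqueNumber≤ G k →
    ∀ (r : ℚ) → (IsZF (copies k G) r ⇔ IsChiF G r)
      × (IsChiF (copies k G) r ⇔ IsChiF G r)
theorem3 G k ω≤k r =
  minimum-transfer (coloringWeight G) (cocoloringWeight kG)
    (λ d → asCocoloring (liftColoring d)) (reduce G k ω≤k)
    (λ d → trans (asCocoloring-weight (liftColoring d)) (liftColoring-weight d)) (reduce-weight G k ω≤k) r
  ,
  minimum-transfer (coloringWeight G) (coloringWeight kG)
    liftColoring (λ c → reduce G k ω≤k (asCocoloring c))
    liftColoring-weight (λ c → ≤-trans (reduce-weight G k ω≤k (asCocoloring c)) (≤-reflexive (asCocoloring-weight c))) r
  where
  open Copies G k using (kG)
  open Lifting G k
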